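{- The property of being the equivalent algebraic semantics of an algebraizable logic (i.e., of being a prevariety of logic) is not preserved by category equivalences between prevarieties, nor between quasivarieties, nor between varieties. That is, for each of these three kinds of classes, there exist two categorically equivalent classes of that kind, one of which is a prevariety of logic and the other of which is not.
   Context: A class of similar algebras is a prevariety if closed under isomorphic images, subalgebras and direct products; a quasivariety if moreover closed under ultraproducts; a variety if closed under homomorphic images, subalgebras and direct products. Such a class is viewed as a concrete category whose morphisms are all homomorphisms between its members. A prevariety $\mathsf{K}$ is a prevariety of logic (equivalently, the equivalent algebraic semantics of an algebraizable logic) if there are sets $I,J$, a family $\{\langle\delta_i,\varepsilon_i\rangle:i\in I\}$ of pairs of unary terms and a family $\{\rho_j:j\in J\}$ of binary terms in the signature of $\mathsf{K}$ such that the infinitary formula $\big(\&_{i\in I,\,j\in J}\ \delta_i(\rho_j(x,y))\approx\varepsilon_i(\rho_j(x,y))\big)\Longleftrightarrow x\approx y$ is valid in every member of $\mathsf{K}$. -}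

module Defs where

open import Data.Nat using (ℕ; zero; suc)
open import Data.Fin using (Fin; zero; suc)
open import Data.Product using (Σ; Σ-syntax; _×_; _,_; proj₁; proj₂)
open import Data.Sum using (_⊎_; inj₁; inj₂)
open import Data.Unit using (⊤; tt)
open import Data.Empty using (⊥)
open import Relation.Nullary using (¬_)
open import Function using (_∘_)

record Signature : Set₁ where
  field
    Op    : Set
    arity : Op → ℕ
open Signature public

record Algebra (S : Signature) : Set₁ where
  field
    Carrier : Set
    _≈_     : Carrier → Carrier → Set
    ≈-refl  : ∀ {x} → x ≈ x
    ≈-sym   : ∀ {x y} → x ≈ y → y ≈ x
    ≈-trans : ∀ {x y z} → x ≈ y → y ≈ z → x ≈ z
    op      : (f : Op S) → (Fin (arity S f) → Carrier) → Carrier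
    op-cong : ∀ f {as bs : Fin (arity S f) → Carrier} →
              (∀ k → as k ≈ bs k) → op f as ≈ op f bs
open Algebra public

module _ {S : Signature} where

  Eq : (A : Algebra S) → Carrier A → Carrier A → Set
  Eq A = _≈_ A

  data Term (X : Set) : Set where
    var  : X → Term X
    node : (f : Op S) → (Fin (arity S f) → Term X) → Term X

  eval : {X : Set} (A : Algebra S) → Term X → (X → Carrier A) → Carrier A
  eval A (var x)     env = env x
  eval A (node f ts) env = op A f (λ k → eval A (ts k) env)

  record Hom (A B : Algebra S) : Set where
    field
      map     : Carrier A → Carrier B
      map-cong : ∀ {x y} → Eq A x y → Eq B (map x) (map y)
      map-op  : ∀ f (as : Fin (arity S f) → Carrier A) →
                Eq B (map (op A f as)) (op B f (map ∘ as))
  open Hom public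

  idHom : (A : Algebra S) → Hom A A
  idHom A = record { map = λ x → x ; map-cong = λ p → p
                   ; map-op = λ f as → ≈-refl A }

  _∘H_ : {A B C : Algebra S} → Hom B C → Hom A B → Hom A C
  _∘H_ {A} {B} {C} g f = record
    { map = λ x → map g (map f x)
    ; map-cong = λ p → map-cong g (map-cong f p)
    ; map-op = λ h as → ≈-trans C (map-cong g (map-op f h as)) (map-op g h (map f ∘ as)) }

  HomEq : {A B : Algebra S} → Hom A B → Hom A B → Set
  HomEq {A} {B} f g = ∀ x → Eq B (map f x) (map g x)

  Surjective : {A B : Algebra S} → Hom A B → Set
  Surjective {A} {B} h = ∀ b → Σ[ a ∈ Carrier A ] Eq B (map h a) b

  record _≅_ (A B : Algebra S) : Set where
    field
      to   : Hom A B
      from : Hom B A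
      to∘from : HomEq (to ∘H from) (idHom B)
      from∘to : HomEq (from ∘H to) (idHom A)

  record Subuniverse (A : Algebra S) : Set₁ where
    field
      P      : Carrier A → Set
      P-resp : ∀ {x y} → Eq A x y → P x → P y
      P-op   : ∀ f (as : Fin (arity S f) → Carrier A) →
               (∀ k → P (as k)) → P (op A f as)
  open Subuniverse public

  Sub : (A : Algebra S) → Subuniverse A → Algebra S
  Sub A U = record
    { Carrier = Σ (Carrier A) (P U)
    ; _≈_ = λ x y → Eq A (proj₁ x) (proj₁ y)
    ; ≈-refl = ≈-refl A
    ; ≈-sym = ≈-sym A
    ; ≈-trans = ≈-trans A
    ; op = λ f as → op A f (proj₁ ∘ as) , P-op U f (proj₁ ∘ as) (proj₂ ∘ as)
    ; op-cong = λ f ps → op-cong A f ps }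

  Π : (I : Set) → (I → Algebra S) → Algebra S
  Π I A = record
    { Carrier = (i : I) → Carrier (A i)
    ; _≈_ = λ x y → ∀ i → Eq (A i) (x i) (y i)
    ; ≈-refl = λ i → ≈-refl (A i)
    ; ≈-sym = λ p i → ≈-sym (A i) (p i)
    ; ≈-trans = λ p q i → ≈-trans (A i) (p i) (q i)
    ; op = λ f as i → op (A i) f (λ k → as k i)
    ; op-cong = λ f ps i → op-cong (A i) f (λ k → ps k i) }

record IsUltrafilter {I : Set} (U : (I → Set) → Set) : Set₁ where
  field
    whole  : U (λ _ → ⊤)
    proper : ¬ U (λ _ → ⊥)
    up     : ∀ X Y → (∀ i → X i → Y i) → U X → U Y
    meet   : ∀ X Y → U X → U Y → U (λ i → X i × Y i)
    ultra  : ∀ X → U X ⊎ U (λ i → ¬ X i)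

module _ {I : Set} {U : (I → Set) → Set} (uf : IsUltrafilter U) where
  open IsUltrafilter uf

  meetFin : ∀ n (X : Fin n → I → Set) → (∀ k → U (X k)) → U (λ i → ∀ k → X k i)
  meetFin zero X h = up _ _ (λ i _ ()) whole
  meetFin (suc n) X h =
    up _ _ (λ i p → λ { zero → proj₁ p ; (suc k) → proj₂ p k })
       (meet _ _ (h zero) (meetFin n (X ∘ suc) (h ∘ suc)))

Ultraproduct : {S : Signature} (I : Set) (A : I → Algebra S)
               (U : (I → Set) → Set) → IsUltrafilter U → Algebra S
Ultraproduct {S} I A U uf = record
  { Carrier = (i : I) → Carrier (A i)
  ; _≈_ = λ x y → U (λ i → Eq (A i) (x i) (y i))
  ; ≈-refl = up _ _ (λ i _ → ≈-refl (A i)) whole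
  ; ≈-sym = up _ _ (λ i → ≈-sym (A i))
  ; ≈-trans = λ p q → up _ _ (λ i r → ≈-trans (A i) (proj₁ r) (proj₂ r)) (meet _ _ p q)
  ; op = λ f as i → op (A i) f (λ k → as k i)
  ; op-cong = λ f ps → up _ _ (λ i r → op-cong (A i) f r)
                          (meetFin uf (arity S f) _ ps) }
  where open IsUltrafilter uf

Class : Signature → Set₂
Class S = Algebra S → Set₁

module _ {S : Signature} (K : Class S) where

  IsoClosed : Set₁
  IsoClosed = ∀ A B → A ≅ B → K A → K B

  SubClosed : Set₁
  SubClosed = ∀ A (U : Subuniverse A) → K A → K (Sub A U)

  ProdClosed : Set₁
  ProdClosed = ∀ (I : Set) (A : I → Algebra S) → (∀ i → K (A i)) → K (Π I A)

  UltraprodClosed : Set₁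
  UltraprodClosed = ∀ (I : Set) (A : I → Algebra S) (U : (I → Set) → Set)
    (uf : IsUltrafilter U) → (∀ i → K (A i)) → K (Ultraproduct I A U uf)

  HomImageClosed : Set₁
  HomImageClosed = ∀ A B (h : Hom A B) → Surjective h → K A → K B

  Prevariety : Set₁
  Prevariety = IsoClosed × SubClosed × ProdClosed

  Quasivariety : Set₁
  Quasivariety = Prevariety × UltraprodClosed

  Variety : Set₁
  Variety = HomImageClosed × SubClosed × ProdClosed

  env₂ : {A : Algebra S} → Carrier A → Carrier A → Fin 2 → Carrier A
  env₂ a b zero    = a
  env₂ a b (suc _) = b

  OfLogic : Set₁
  OfLogic =
    Σ[ I ∈ Set ] Σ[ J ∈ Set ]
    Σ[ δ ∈ (I → Term (Fin 1)) ] Σ[ ε ∈ (I → Term (Fin 1)) ]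
    Σ[ ρ ∈ (J → Term (Fin 2)) ]
      (∀ A → K A → ∀ (a b : Carrier A) →
        let r = λ j → eval A (ρ j) (env₂ {A} a b) in
        ((∀ i j → Eq A (eval A (δ i) (λ _ → r j)) (eval A (ε i) (λ _ → r j)))
           → Eq A a b)
        × (Eq A a b →
           ∀ i j → Eq A (eval A (δ i) (λ _ → r j)) (eval A (ε i) (λ _ → r j))))

-- A class as a concrete category: objects are members, morphisms all homs

Obj : {S : Signature} → Class S → Set₁
Obj {S} K = Σ[ A ∈ Algebra S ] K A

alg : {S : Signature} {K : Class S} → Obj K → Algebra S
alg = proj₁

record Functor {S₁ S₂ : Signature} (K₁ : Class S₁) (K₂ : Class S₂) : Set₁ where
  A₁ : Obj K₁ → Algebra S₁
  A₁ = alg {K = K₁}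
  A₂ : Obj K₂ → Algebra S₂
  A₂ = alg {K = K₂}
  field
    F₀    : Obj K₁ → Obj K₂
    F₁    : ∀ {A B} → Hom (A₁ A) (A₁ B) → Hom (A₂ (F₀ A)) (A₂ (F₀ B))
    F-cong : ∀ {A B} {f g : Hom (A₁ A) (A₁ B)} → HomEq f g → HomEq (F₁ {A} {B} f) (F₁ {A} {B} g)
    F-id  : ∀ {A} → HomEq (F₁ {A} {A} (idHom (A₁ A))) (idHom (A₂ (F₀ A)))
    F-∘   : ∀ {A B C} (g : Hom (A₁ B) (A₁ C)) (f : Hom (A₁ A) (A₁ B)) →
            HomEq (F₁ {A} {C} (g ∘H f)) (F₁ {B} {C} g ∘H F₁ {A} {B} f)
open Functor public

record CatEquivalent {S₁ S₂ : Signature} (K₁ : Class S₁) (K₂ : Class S₂) : Set₁ where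
  field
    F : Functor K₁ K₂
    G : Functor K₂ K₁
    η     : ∀ A → Hom (alg A) (alg (F₀ G (F₀ F A)))
    η⁻¹   : ∀ A → Hom (alg (F₀ G (F₀ F A))) (alg A)
    η-inv₁ : ∀ A → HomEq (η⁻¹ A ∘H η A) (idHom (alg A))
    η-inv₂ : ∀ A → HomEq (η A ∘H η⁻¹ A) (idHom (alg (F₀ G (F₀ F A))))
    η-nat : ∀ {A B} (f : Hom (alg A) (alg B)) →
            HomEq (η B ∘H f) (F₁ G {F₀ F A} {F₀ F B} (F₁ F {A} {B} f) ∘H η A)
    ε     : ∀ B → Hom (alg B) (alg (F₀ F (F₀ G B)))
    ε⁻¹   : ∀ B → Hom (alg (F₀ F (F₀ G B))) (alg B)
    ε-inv₁ : ∀ B → HomEq (ε⁻¹ B ∘H ε B) (idHom (alg B))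
    ε-inv₂ : ∀ B → HomEq (ε B ∘H ε⁻¹ B) (idHom (alg (F₀ F (F₀ G B))))
    ε-nat : ∀ {A B} (f : Hom (alg A) (alg B)) →
            HomEq (ε B ∘H f) (F₁ F {F₀ G A} {F₀ G B} (F₁ G {A} {B} f) ∘H ε A)

NotPreservedAmong : (∀ {S} → Class S → Set₁) → Set₂
NotPreservedAmong P =
  Σ[ S₁ ∈ Signature ] Σ[ S₂ ∈ Signature ]
  Σ[ K₁ ∈ Class S₁ ] Σ[ K₂ ∈ Class S₂ ]
    P K₁ × P K₂ × CatEquivalent K₁ K₂ × OfLogic K₁ × ¬ OfLogic K₂

{-# OPTIONS --safe #-}
module Submission where

-- Involutive rectangular bands (x·x = x, (x·y)·z = x·z = x·(y·z), σσx = x,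
-- σ(x·y) = σy·σx) are, up to isomorphism, the squares X × X of sets with
-- (a,b)·(c,d) = (a,d) and σ(a,b) = (b,a): an algebra A is recovered from the
-- set of σ-fixed points via a ↦ (a·σa, σa·a). Hence this variety is
-- categorically equivalent to the variety of sets. It is a prevariety of logic,
-- since a ≈ b iff both a·σb and σa·b are σ-fixed (in the square model these say
-- a₁ = b₁ and a₂ = b₂). The variety of sets is not: over the empty signature
-- every unary term is the variable, so δ(ρ(a,b)) ≈ ε(ρ(a,b)) holds for all a, b.

open import Defs
open import Data.Bool using (Bool; true; false)
open import Data.Empty using (⊥)
open import Data.Fin using (Fin; zero; suc)
open import Data.Nat using (ℕ)
open import Data.Product using (Σ; _×_; _,_; proj₁; proj₂)
open import Data.Unit using (⊤; tt)
open import Function using (_∘_)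
open import Level using (Lift; lift; lower)
open import Relation.Binary.Bundles using (Setoid)
open import Relation.Binary.PropositionalEquality as ≡ using (_≡_)
open import Relation.Nullary using (¬_)
import Relation.Binary.Reasoning.Setoid as SetoidReasoning

module _ {S : Signature} where

  setoidOf : Algebra S → Setoid Level.zero Level.zero
  setoidOf A = record
    { Carrier = Carrier A ; _≈_ = Eq A
    ; isEquivalence = record { refl = ≈-refl A ; sym = ≈-sym A ; trans = ≈-trans A } }

  eval-hom : {X : Set} {A B : Algebra S} (h : Hom A B) (t : Term X) (e : X → Carrier A) →
             Eq B (map h (eval A t e)) (eval B t (map h ∘ e))
  eval-hom {B = B} h (var x) e = ≈-refl B
  eval-hom {A = A} {B} h (node f ts) e =
    ≈-trans B (map-op h f (λ k → eval A (ts k) e)) (op-cong B f (λ k → eval-hom h (ts k) e))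

  eval-cong : {X : Set} (A : Algebra S) (t : Term X) {e e′ : X → Carrier A} →
              (∀ x → Eq A (e x) (e′ x)) → Eq A (eval A t e) (eval A t e′)
  eval-cong A (var x) p = p x
  eval-cong A (node f ts) p = op-cong A f (λ k → eval-cong A (ts k) p)

  inclusion : (A : Algebra S) (U : Subuniverse A) → Hom (Sub A U) A
  inclusion A U = record { map = proj₁ ; map-cong = λ p → p ; map-op = λ f as → ≈-refl A }

  projection : (I : Set) (A : I → Algebra S) (i : I) → Hom (Π I A) (A i)
  projection I A i = record { map = λ x → x i ; map-cong = λ p → p i ; map-op = λ f as → ≈-refl (A i) }

  Π↠Ultraproduct : (I : Set) (A : I → Algebra S) (U : (I → Set) → Set) (uf : IsUltrafilter U) →
                   Hom (Π I A) (Ultraproduct I A U uf)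
  Π↠Ultraproduct I A U uf = record
    { map = λ x → x
    ; map-cong = λ p → up _ _ (λ i _ → p i) whole
    ; map-op = λ f as → ≈-refl (Ultraproduct I A U uf) }
    where open IsUltrafilter uf

  Π↠Ultraproduct-surjective : (I : Set) (A : I → Algebra S) (U : (I → Set) → Set)
                              (uf : IsUltrafilter U) → Surjective (Π↠Ultraproduct I A U uf)
  Π↠Ultraproduct-surjective I A U uf x = x , ≈-refl (Ultraproduct I A U uf)

  module _ (K : Class S) where

    homImageClosed⇒isoClosed : HomImageClosed K → IsoClosed K
    homImageClosed⇒isoClosed hK A B A≅B =
      hK A B (_≅_.to A≅B) (λ b → map (_≅_.from A≅B) b , _≅_.to∘from A≅B b)

    -- An ultraproduct is a quotient of the direct product.
    homImageClosed⇒ultraprodClosed : HomImageClosed K → ProdClosed K → UltraprodClosed K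
    homImageClosed⇒ultraprodClosed hK pK I A U uf KA =
      hK (Π I A) _ (Π↠Ultraproduct I A U uf) (Π↠Ultraproduct-surjective I A U uf) (pK I A KA)

    variety⇒quasivariety : Variety K → Quasivariety K
    variety⇒quasivariety (hK , sK , pK) =
      (homImageClosed⇒isoClosed hK , sK , pK) , homImageClosed⇒ultraprodClosed hK pK

  Everything : Class S
  Everything _ = Lift _ ⊤

  Everything-variety : Variety Everything
  Everything-variety = (λ _ _ _ _ _ → lift tt) , (λ _ _ _ → lift tt) , (λ _ _ _ → lift tt)

  module _ {X Ix : Set} (E : Ix → Term {S} X × Term {S} X) where

    Satisfies : Algebra S → Set
    Satisfies A = ∀ ix (e : X → Carrier A) →
                  Eq A (eval A (proj₁ (E ix)) e) (eval A (proj₂ (E ix)) e)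

    Mod : Class S
    Mod A = Lift _ (Satisfies A)

    satisfies-surjection : {A B : Algebra S} (h : Hom A B) → Surjective h →
                           Satisfies A → Satisfies B
    satisfies-surjection {A} {B} h surj sat ix e = begin
      eval B l e               ≈⟨ eval-cong B l (λ x → ≈-sym B (proj₂ (surj (e x)))) ⟩
      eval B l (map h ∘ e′)    ≈⟨ eval-hom h l e′ ⟨
      map h (eval A l e′)      ≈⟨ map-cong h (sat ix e′) ⟩
      map h (eval A r e′)      ≈⟨ eval-hom h r e′ ⟩
      eval B r (map h ∘ e′)    ≈⟨ eval-cong B r (λ x → proj₂ (surj (e x))) ⟩
      eval B r e               ∎
      where
      open SetoidReasoning (setoidOf B)
      l r : Term X
      l = proj₁ (E ix)
      r = proj₂ (E ix)
      e′ : X → Carrier A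
      e′ x = proj₁ (surj (e x))

    satisfies-reflected : {J : Set} {A : Algebra S} {B : J → Algebra S} (h : ∀ j → Hom A (B j)) →
                          (∀ {x y} → (∀ j → Eq (B j) (map (h j) x) (map (h j) y)) → Eq A x y) →
                          (∀ j → Satisfies (B j)) → Satisfies A
    satisfies-reflected {A = A} {B} h reflect sat ix e = reflect λ j →
      let open SetoidReasoning (setoidOf (B j)) in begin
      map (h j) (eval A l e)         ≈⟨ eval-hom (h j) l e ⟩
      eval (B j) l (map (h j) ∘ e)   ≈⟨ sat j ix (map (h j) ∘ e) ⟩
      eval (B j) r (map (h j) ∘ e)   ≈⟨ eval-hom (h j) r e ⟨
      map (h j) (eval A r e)         ∎
      where
      l r : Term X
      l = proj₁ (E ix)
      r = proj₂ (E ix)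

    Mod-variety : Variety Mod
    Mod-variety =
        (λ A B h surj KA → lift (satisfies-surjection h surj (lower KA)))
      , (λ A U KA → lift (satisfies-reflected (λ (_ : ⊤) → inclusion A U) (λ p → p tt) (λ _ → lower KA)))
      , (λ I A KA → lift (satisfies-reflected (projection I A) (λ p → p) (lower ∘ KA)))

Sets : Signature
Sets = record { Op = ⊥ ; arity = λ () }

discrete : Set → Algebra Sets
discrete C = record
  { Carrier = C ; _≈_ = _≡_ ; ≈-refl = ≡.refl ; ≈-sym = ≡.sym ; ≈-trans = ≡.trans
  ; op = λ () ; op-cong = λ () }

eval-constant : {X : Set} (A : Algebra Sets) (t : Term X) (c : Carrier A) →
                Eq A (eval A t (λ _ → c)) c
eval-constant A (var x) c = ≈-refl A
eval-constant A (node () ts) c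

¬ofLogic-Sets : (K : Class Sets) (A : Algebra Sets) → K A →
                (a b : Carrier A) → ¬ Eq A a b → ¬ OfLogic K
¬ofLogic-Sets K A KA a b a≉b (_ , _ , δ , ε , _ , logic) =
  a≉b (proj₁ (logic A KA a b) λ i j →
    ≈-trans A (eval-constant A (δ i) _) (≈-sym A (eval-constant A (ε i) _)))

data BandOp : Set where
  mul inv : BandOp

bandArity : BandOp → ℕ
bandArity mul = 2
bandArity inv = 1

InvBand : Signature
InvBand = record { Op = BandOp ; arity = bandArity }

infixl 7 _·ₜ_

_·ₜ_ : {X : Set} → Term {InvBand} X → Term {InvBand} X → Term {InvBand} X
t ·ₜ u = node mul (λ { zero → t ; (suc _) → u })

σₜ : {X : Set} → Term {InvBand} X → Term {InvBand} X
σₜ t = node inv (λ _ → t)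

𝑥 𝑦 𝑧 : Term {InvBand} (Fin 3)
𝑥 = var zero
𝑦 = var (suc zero)
𝑧 = var (suc (suc zero))

data BandAxiom : Set where
  σ-involutive ·-idempotent ·-rectangularˡ ·-rectangularʳ σ-antihomomorphism : BandAxiom

bandAxiom : BandAxiom → Term {InvBand} (Fin 3) × Term {InvBand} (Fin 3)
bandAxiom σ-involutive       = σₜ (σₜ 𝑥) , 𝑥
bandAxiom ·-idempotent       = 𝑥 ·ₜ 𝑥 , 𝑥
bandAxiom ·-rectangularˡ     = 𝑥 ·ₜ 𝑦 ·ₜ 𝑧 , 𝑥 ·ₜ 𝑧
bandAxiom ·-rectangularʳ     = 𝑥 ·ₜ (𝑦 ·ₜ 𝑧) , 𝑥 ·ₜ 𝑧
bandAxiom σ-antihomomorphism = σₜ (𝑥 ·ₜ 𝑦) , σₜ 𝑦 ·ₜ σₜ 𝑥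

InvRectBands : Class InvBand
InvRectBands = Mod bandAxiom

module BandOps (A : Algebra InvBand) where
  infixl 7 _·_

  _·_ : Carrier A → Carrier A → Carrier A
  a · b = op A mul (λ { zero → a ; (suc _) → b })

  σ : Carrier A → Carrier A
  σ a = op A inv (λ _ → a)

  ·-cong : ∀ {a a′ b b′} → Eq A a a′ → Eq A b b′ → Eq A (a · b) (a′ · b′)
  ·-cong p q = op-cong A mul (λ { zero → p ; (suc _) → q })

  σ-cong : ∀ {a a′} → Eq A a a′ → Eq A (σ a) (σ a′)
  σ-cong p = op-cong A inv (λ _ → p)

  op-mul : ∀ as → Eq A (op A mul as) (as zero · as (suc zero))
  op-mul as = op-cong A mul (λ { zero → ≈-refl A ; (suc zero) → ≈-refl A })

  op-inv : ∀ as → Eq A (op A inv as) (σ (as zero))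
  op-inv as = op-cong A inv (λ { zero → ≈-refl A })

  eval-· : {X : Set} (t u : Term {InvBand} X) (e : X → Carrier A) →
           Eq A (eval A (t ·ₜ u) e) (eval A t e · eval A u e)
  eval-· t u e = op-mul _

module _ {A B : Algebra InvBand} (h : Hom A B) where
  private
    module A = BandOps A
    module B = BandOps B

  map-· : ∀ a b → Eq B (map h (a A.· b)) (map h a B.· map h b)
  map-· a b = ≈-trans B (map-op h mul _) (B.op-mul _)

  map-σ : ∀ a → Eq B (map h (A.σ a)) (B.σ (map h a))
  map-σ a = map-op h inv _

  map-·σ : ∀ a → Eq B (map h (a A.· A.σ a)) (map h a B.· B.σ (map h a))
  map-·σ a = ≈-trans B (map-· a (A.σ a)) (B.·-cong (≈-refl B) (map-σ a))

  map-σ· : ∀ a → Eq B (map h (A.σ a A.· a)) (B.σ (map h a) B.· map h a)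
  map-σ· a = ≈-trans B (map-· (A.σ a) a) (B.·-cong (map-σ a) (≈-refl B))

module BandLaws (A : Algebra InvBand) (sat : Satisfies bandAxiom A) where
  open BandOps A public
  open SetoidReasoning (setoidOf A) public

  private
    env : Carrier A → Carrier A → Carrier A → Fin 3 → Carrier A
    env a b c zero = a
    env a b c (suc zero) = b
    env a b c (suc (suc _)) = c

  σσ : ∀ a → Eq A (σ (σ a)) a
  σσ a = sat σ-involutive (env a a a)

  ·-idem : ∀ a → Eq A (a · a) a
  ·-idem a = begin
    a · a                ≈⟨ eval-· 𝑥 𝑥 (env a a a) ⟨
    eval A (𝑥 ·ₜ 𝑥) _    ≈⟨ sat ·-idempotent (env a a a) ⟩
    a                    ∎

  ·-rectˡ : ∀ a b c → Eq A (a · b · c) (a · c)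
  ·-rectˡ a b c = begin
    a · b · c                        ≈⟨ ·-cong (eval-· 𝑥 𝑦 e) (≈-refl A) ⟨
    eval A (𝑥 ·ₜ 𝑦) e · c             ≈⟨ eval-· (𝑥 ·ₜ 𝑦) 𝑧 e ⟨
    eval A (𝑥 ·ₜ 𝑦 ·ₜ 𝑧) e            ≈⟨ sat ·-rectangularˡ e ⟩
    eval A (𝑥 ·ₜ 𝑧) e                 ≈⟨ eval-· 𝑥 𝑧 e ⟩
    a · c                            ∎
    where
    e : Fin 3 → Carrier A
    e = env a b c

  ·-rectʳ : ∀ a b c → Eq A (a · (b · c)) (a · c)
  ·-rectʳ a b c = begin
    a · (b · c)                      ≈⟨ ·-cong (≈-refl A) (eval-· 𝑦 𝑧 e) ⟨
    a · eval A (𝑦 ·ₜ 𝑧) e             ≈⟨ eval-· 𝑥 (𝑦 ·ₜ 𝑧) e ⟨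
    eval A (𝑥 ·ₜ (𝑦 ·ₜ 𝑧)) e          ≈⟨ sat ·-rectangularʳ e ⟩
    eval A (𝑥 ·ₜ 𝑧) e                 ≈⟨ eval-· 𝑥 𝑧 e ⟩
    a · c                            ∎
    where
    e : Fin 3 → Carrier A
    e = env a b c

  σ-· : ∀ a b → Eq A (σ (a · b)) (σ b · σ a)
  σ-· a b = begin
    σ (a · b)                        ≈⟨ σ-cong (eval-· 𝑥 𝑦 e) ⟨
    eval A (σₜ (𝑥 ·ₜ 𝑦)) e            ≈⟨ sat σ-antihomomorphism e ⟩
    eval A (σₜ 𝑦 ·ₜ σₜ 𝑥) e           ≈⟨ eval-· (σₜ 𝑦) (σₜ 𝑥) e ⟩
    σ b · σ a                        ∎
    where
    e : Fin 3 → Carrier A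
    e = env a b a

  σ-·σ : ∀ a b → Eq A (σ (a · σ b)) (b · σ a)
  σ-·σ a b = ≈-trans A (σ-· a (σ b)) (·-cong (σσ b) (≈-refl A))

  σ-σ· : ∀ a b → Eq A (σ (σ a · b)) (σ b · a)
  σ-σ· a b = ≈-trans A (σ-· (σ a) b) (·-cong (≈-refl A) (σσ a))

  σ-fixed-resp : ∀ {x y} → Eq A x y → Eq A x (σ x) → Eq A y (σ y)
  σ-fixed-resp p q = ≈-trans A (≈-sym A p) (≈-trans A q (σ-cong p))

  ·σ-cancel : ∀ a b → Eq A (a · σ b) (b · σ a) → Eq A (σ a · b) (σ b · a) → Eq A a b
  ·σ-cancel a b p q = begin
    a               ≈⟨ ·-idem a ⟨
    a · a           ≈⟨ ·-rectˡ a (σ b) a ⟨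
    a · σ b · a     ≈⟨ ·-cong p (≈-refl A) ⟩
    b · σ a · a     ≈⟨ ·-rectˡ b (σ a) a ⟩
    b · a           ≈⟨ ·-rectʳ b (σ b) a ⟨
    b · (σ b · a)   ≈⟨ ·-cong (≈-refl A) (≈-sym A q) ⟩
    b · (σ a · b)   ≈⟨ ·-rectʳ b (σ a) b ⟩
    b · b           ≈⟨ ·-idem b ⟩
    b               ∎

squareOp : {C : Set} (f : BandOp) → (Fin (bandArity f) → C × C) → C × C
squareOp mul as = proj₁ (as zero) , proj₂ (as (suc zero))
squareOp inv as = proj₂ (as zero) , proj₁ (as zero)

Square : Algebra Sets → Algebra InvBand
Square X = record
  { Carrier = Carrier X × Carrier X
  ; _≈_ = λ p q → Eq X (proj₁ p) (proj₁ q) × Eq X (proj₂ p) (proj₂ q)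
  ; ≈-refl = ≈-refl X , ≈-refl X
  ; ≈-sym = λ (p , q) → ≈-sym X p , ≈-sym X q
  ; ≈-trans = λ (p , q) (p′ , q′) → ≈-trans X p p′ , ≈-trans X q q′
  ; op = squareOp
  ; op-cong = λ { mul p → proj₁ (p zero) , proj₂ (p (suc zero))
                ; inv p → proj₂ (p zero) , proj₁ (p zero) } }

Square-satisfies : (X : Algebra Sets) → Satisfies bandAxiom (Square X)
Square-satisfies X σ-involutive       e = ≈-refl (Square X)
Square-satisfies X ·-idempotent       e = ≈-refl (Square X)
Square-satisfies X ·-rectangularˡ     e = ≈-refl (Square X)
Square-satisfies X ·-rectangularʳ     e = ≈-refl (Square X)
Square-satisfies X σ-antihomomorphism e = ≈-refl (Square X)

Fixed : Algebra InvBand → Algebra Sets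
Fixed A = record
  { Carrier = Σ (Carrier A) (λ a → Eq A (σ a) a)
  ; _≈_ = λ x y → Eq A (proj₁ x) (proj₁ y)
  ; ≈-refl = ≈-refl A
  ; ≈-sym = ≈-sym A
  ; ≈-trans = ≈-trans A
  ; op = λ ()
  ; op-cong = λ () }
  where open BandOps A

module Coordinates (A : Algebra InvBand) (sat : Satisfies bandAxiom A) where
  open BandLaws A sat

  private
    T : Algebra InvBand
    T = Square (Fixed A)

  coordinates : Carrier A → Carrier T
  coordinates a = (a · σ a , σ-·σ a a) , (σ a · a , σ-σ· a a)

  ·σ-coordinate : ∀ a b → Eq A (a · b · σ (a · b)) (a · σ a)
  ·σ-coordinate a b = begin
    a · b · σ (a · b)     ≈⟨ ·-rectˡ a b _ ⟩
    a · σ (a · b)         ≈⟨ ·-cong (≈-refl A) (σ-· a b) ⟩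
    a · (σ b · σ a)       ≈⟨ ·-rectʳ a _ _ ⟩
    a · σ a               ∎

  σ·-coordinate : ∀ a b → Eq A (σ (a · b) · (a · b)) (σ b · b)
  σ·-coordinate a b = begin
    σ (a · b) · (a · b)   ≈⟨ ·-rectʳ _ a b ⟩
    σ (a · b) · b         ≈⟨ ·-cong (σ-· a b) (≈-refl A) ⟩
    σ b · σ a · b         ≈⟨ ·-rectˡ _ _ b ⟩
    σ b · b               ∎

  coordinates-cong : ∀ {a a′} → Eq A a a′ → Eq T (coordinates a) (coordinates a′)
  coordinates-cong p = ·-cong p (σ-cong p) , ·-cong (σ-cong p) p

  coordinatesHom : Hom A T
  coordinatesHom = record
    { map = coordinates
    ; map-cong = coordinates-cong
    ; map-op = coordinates-op }
    where
    coordinates-op : ∀ f as → Eq T (coordinates (op A f as)) (op T f (coordinates ∘ as))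
    coordinates-op mul as =
        ≈-trans A (·-cong p (σ-cong p)) (·σ-coordinate (as zero) (as (suc zero)))
      , ≈-trans A (·-cong (σ-cong p) p) (σ·-coordinate (as zero) (as (suc zero)))
      where
      p : Eq A (op A mul as) (as zero · as (suc zero))
      p = op-mul as
    coordinates-op inv as =
        ≈-trans A (·-cong p (σ-cong p)) (·-cong (≈-refl A) (σσ (as zero)))
      , ≈-trans A (·-cong (σ-cong p) p) (·-cong (σσ (as zero)) (≈-refl A))
      where
      p : Eq A (op A inv as) (σ (as zero))
      p = op-inv as

  recombine : Carrier T → Carrier A
  recombine ((d , _) , (e , _)) = d · e

  recombineHom : Hom T A
  recombineHom = record
    { map = recombine
    ; map-cong = λ (p , q) → ·-cong p q
    ; map-op = recombine-op }
    where
    recombine-op : ∀ f as → Eq A (recombine (op T f as)) (op A f (recombine ∘ as))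
    recombine-op mul as = ≈-sym A (≈-trans A (op-mul _) (≈-trans A (·-rectˡ _ _ _) (·-rectʳ _ _ _)))
    recombine-op inv as =
      let ((d , σd≈d) , (e , σe≈e)) = as zero in
      ≈-sym A (≈-trans A (op-inv _) (≈-trans A (σ-· d e) (·-cong σe≈e σd≈d)))

  recombine-coordinates : ∀ a → Eq A (recombine (coordinates a)) a
  recombine-coordinates a = ≈-trans A (·-rectˡ _ _ _) (≈-trans A (·-rectʳ _ _ _) (·-idem a))

  coordinates-recombine : ∀ x → Eq T (coordinates (recombine x)) x
  coordinates-recombine ((d , σd≈d) , (e , σe≈e)) =
      ≈-trans A (·σ-coordinate d e) (≈-trans A (·-cong (≈-refl A) σd≈d) (·-idem d))
    , ≈-trans A (σ·-coordinate d e) (≈-trans A (·-cong σe≈e (≈-refl A)) (·-idem e))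

SquareFunctor : Functor Everything InvRectBands
SquareFunctor = record
  { F₀ = λ (X , _) → Square X , lift (Square-satisfies X)
  ; F₁ = λ {_} {(Y , _)} h → record
      { map = λ (a , b) → map h a , map h b
      ; map-cong = λ (p , q) → map-cong h p , map-cong h q
      ; map-op = λ { mul as → ≈-refl (Square Y) ; inv as → ≈-refl (Square Y) } }
  ; F-cong = λ p (a , b) → p a , p b
  ; F-id = λ {(X , _)} _ → ≈-refl (Square X)
  ; F-∘ = λ {_} {_} {(Z , _)} _ _ _ → ≈-refl (Square Z) }

FixedFunctor : Functor InvRectBands Everything
FixedFunctor = record
  { F₀ = λ (A , _) → Fixed A , lift tt
  ; F₁ = λ {_} {(B , _)} h → record
      { map = λ (a , σa≈a) → map h a , ≈-trans B (≈-sym B (map-σ h a)) (map-cong h σa≈a)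
      ; map-cong = map-cong h
      ; map-op = λ () }
  ; F-cong = λ p (a , _) → p a
  ; F-id = λ {(A , _)} _ → ≈-refl A
  ; F-∘ = λ {_} {_} {(C , _)} _ _ _ → ≈-refl C }

InvRectBands≃Sets : CatEquivalent InvRectBands Everything
InvRectBands≃Sets = record
  { F = FixedFunctor
  ; G = SquareFunctor
  ; η = λ (A , KA) → Coordinates.coordinatesHom A (lower KA)
  ; η⁻¹ = λ (A , KA) → Coordinates.recombineHom A (lower KA)
  ; η-inv₁ = λ (A , KA) → Coordinates.recombine-coordinates A (lower KA)
  ; η-inv₂ = λ (A , KA) → Coordinates.coordinates-recombine A (lower KA)
  ; η-nat = λ {_} {(B , _)} f a → ≈-sym B (map-·σ f a) , ≈-sym B (map-σ· f a)
  ; ε = λ (X , _) → record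
      { map = λ x → (x , x) , ≈-refl X , ≈-refl X
      ; map-cong = λ p → p , p
      ; map-op = λ () }
  ; ε⁻¹ = λ (X , _) → record
      { map = proj₁ ∘ proj₁
      ; map-cong = proj₁
      ; map-op = λ () }
  ; ε-inv₁ = λ (X , _) _ → ≈-refl X
  ; ε-inv₂ = λ (X , _) (_ , _ , x₂≈x₁) → ≈-refl X , x₂≈x₁
  ; ε-nat = λ {_} {(Y , _)} _ _ → ≈-refl Y , ≈-refl Y }

ρ : Bool → Term {InvBand} (Fin 2)
ρ true  = var zero ·ₜ σₜ (var (suc zero))
ρ false = σₜ (var zero) ·ₜ var (suc zero)

module BandLogic (A : Algebra InvBand) (sat : Satisfies bandAxiom A) (a b : Carrier A) where
  open BandLaws A sat public

  ρ-value : Bool → Carrier A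
  ρ-value true  = a · σ b
  ρ-value false = σ a · b

  eval-ρ : ∀ j → Eq A (eval A (ρ j) (env₂ InvRectBands {A} a b)) (ρ-value j)
  eval-ρ true  = eval-· _ _ _
  eval-ρ false = eval-· _ _ _

  ρ-fixed⇒≈ : (∀ j → Eq A (ρ-value j) (σ (ρ-value j))) → Eq A a b
  ρ-fixed⇒≈ fixed =
    ·σ-cancel a b (≈-trans A (fixed true) (σ-·σ a b)) (≈-trans A (fixed false) (σ-σ· a b))

  ≈⇒ρ-fixed : Eq A a b → ∀ j → Eq A (ρ-value j) (σ (ρ-value j))
  ≈⇒ρ-fixed a≈b true  = ≈-trans A (·-cong a≈b (σ-cong (≈-sym A a≈b))) (≈-sym A (σ-·σ a b))
  ≈⇒ρ-fixed a≈b false = ≈-trans A (·-cong (σ-cong a≈b) (≈-sym A a≈b)) (≈-sym A (σ-σ· a b))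

InvRectBands-ofLogic : OfLogic InvRectBands
InvRectBands-ofLogic = ⊤ , Bool , (λ _ → var zero) , (λ _ → σₜ (var zero)) , ρ , λ A KA a b →
  let open BandLogic A (lower KA) a b in
    (λ fixed → ρ-fixed⇒≈ λ j → σ-fixed-resp (eval-ρ j) (fixed tt j))
  , (λ a≈b _ j → σ-fixed-resp (≈-sym A (eval-ρ j)) (≈⇒ρ-fixed a≈b j))

Sets-¬ofLogic : ¬ OfLogic (Everything {Sets})
Sets-¬ofLogic = ¬ofLogic-Sets Everything (discrete Bool) (lift tt) true false λ ()

counterexample : {P : ∀ {S} → Class S → Set₁} → P InvRectBands → P (Everything {Sets}) →
                 NotPreservedAmong P
counterexample P₁ P₂ =
  InvBand , Sets , InvRectBands , Everything , P₁ , P₂ ,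
  InvRectBands≃Sets , InvRectBands-ofLogic , Sets-¬ofLogic

corollary2p4 : NotPreservedAmong Prevariety × NotPreservedAmong Quasivariety × NotPreservedAmong Variety
corollary2p4 =
    counterexample (proj₁ quasi₁) (proj₁ quasi₂)
  , counterexample quasi₁ quasi₂
  , counterexample (Mod-variety bandAxiom) Everything-variety
  where
  quasi₁ : Quasivariety InvRectBands
  quasi₁ = variety⇒quasivariety InvRectBands (Mod-variety bandAxiom)
  quasi₂ : Quasivariety (Everything {Sets})
  quasi₂ = variety⇒quasivariety Everything Everything-variety
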